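{- Let $(U_i)_{i\ge0}$ be defined by $U_0=1$, $U_1=13$, $U_2=163$ and $U_{i+3}=12U_{i+2}+6U_{i+1}+12U_i$ for all $i\ge0$. Then for all $i\ge0$, $$\nu_3(U_i)=\left\lfloor\frac{i}{3}\right\rfloor+\begin{cases}1&\text{if } i\equiv4\pmod 9,\\0&\text{if } i\not\equiv4\pmod 9.\end{cases}$$
   Context: $\nu_3(n)$ denotes the $3$-adic valuation of the non-zero integer $n$ (the exponent of the highest power of $3$ dividing $n$). -}

module Defs where

open import Data.Nat using (ℕ; zero; suc; _+_; _*_; _^_; _/_; _%_)
open import Data.Nat.Divisibility using (_∣_)
open import Data.Product using (_×_)
open import Relation.Nullary using (¬_)

U : ℕ → ℕ
U zero = 1
U (suc zero) = 13
U (suc (suc zero)) = 163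
U (suc (suc (suc i))) = 12 * U (suc (suc i)) + 6 * U (suc i) + 12 * U i

-- "ν₃ n equals k": 3^k divides n and 3^(k+1) does not
-- (for non-zero n this is exactly the 3-adic valuation)
HasVal3 : ℕ → ℕ → Set
HasVal3 n k = (3 ^ k ∣ n) × ¬ (3 ^ suc k ∣ n)

corr : ℕ → ℕ
corr i with i % 9
... | 4 = 1
... | _ = 0

module Submission where

-- Three applications of the recurrence multiply the scale by exactly 3: writing
-- U (3k + r) = 3^k V (3k + r) for r < 3, the triples (V 3k, V (3k+1), V (3k+2)) are
-- natural numbers obeying the linear recurrence step, obtained by dividing the
-- recurrence for U by 3^(k+1). Modulo 9 these triples repeat with period 9, so
-- V i mod 9 depends only on i mod 27. Inspecting the 27 residues shows that
-- ν₃ (V i) is 1 if i ≡ 4 (mod 9) and 0 otherwise; a valuation at most 1 is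
-- determined by the residue mod 9, and ν₃ (U i) = ⌊i/3⌋ + ν₃ (V i).

open import Defs
open import Data.Nat using (ℕ; zero; suc; _+_; _*_; _^_; _/_; _%_; _≤_; _<_; _≤?_; _≟_; NonZero; z≤n; s≤s)
open import Data.Nat.Properties using (+-identityʳ; +-comm; +-assoc; +-suc; ^-distribˡ-+-*; m^n≢0; allUpTo?)
open import Data.Nat.DivMod using (m≡m%n+[m/n]*n; m%n<n; [m+kn]%n≡m%n; %-distribˡ-+; %-distribˡ-*; +-distrib-/-∣ʳ)
open import Data.Nat.Divisibility using (_∣_; _∣?_; divides; ∣-refl; ∣-trans; n∣m*n; *-monoʳ-∣; *-cancelˡ-∣; ∣n∣m%n⇒∣m; %-presˡ-∣)
open import Data.Nat.Tactic.RingSolver using (solve-∀)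
open import Data.Product using (_×_; _,_; proj₁; proj₂)
open import Relation.Nullary using (Dec; ¬?)
open import Relation.Nullary.Decidable using (_×-dec_; from-yes; map′)
open import Relation.Binary.PropositionalEquality using (_≡_; refl; sym; trans; cong; cong₂; subst; subst₂; module ≡-Reasoning)

infix 4 _≡_[mod_]

_≡_[mod_] : ℕ → ℕ → (n : ℕ) → .{{NonZero n}} → Set
x ≡ y [mod n ] = x % n ≡ y % n

module _ {n : ℕ} .{{_ : NonZero n}} where

  +-cong-mod : ∀ {x x′ y y′} → x ≡ x′ [mod n ] → y ≡ y′ [mod n ] → x + y ≡ x′ + y′ [mod n ]
  +-cong-mod {x} {x′} {y} {y′} ex ey = begin
    (x + y) % n                ≡⟨ %-distribˡ-+ x y n ⟩
    (x % n + y % n) % n        ≡⟨ cong₂ (λ u v → (u + v) % n) ex ey ⟩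
    (x′ % n + y′ % n) % n      ≡⟨ sym (%-distribˡ-+ x′ y′ n) ⟩
    (x′ + y′) % n              ∎
    where open ≡-Reasoning

  *-congˡ-mod : ∀ m {x y} → x ≡ y [mod n ] → m * x ≡ m * y [mod n ]
  *-congˡ-mod m {x} {y} e = begin
    (m * x) % n                ≡⟨ %-distribˡ-* m x n ⟩
    (m % n * (x % n)) % n      ≡⟨ cong (λ u → (m % n * u) % n) e ⟩
    (m % n * (y % n)) % n      ≡⟨ sym (%-distribˡ-* m y n) ⟩
    (m * y) % n                ∎
    where open ≡-Reasoning

  lincomb-cong-mod : ∀ α β γ {u u′ v v′ w w′} →
                     u ≡ u′ [mod n ] → v ≡ v′ [mod n ] → w ≡ w′ [mod n ] →
                     α * u + β * v + γ * w ≡ α * u′ + β * v′ + γ * w′ [mod n ]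
  lincomb-cong-mod α β γ eu ev ew =
    +-cong-mod (+-cong-mod (*-congˡ-mod α eu) (*-congˡ-mod β ev)) (*-congˡ-mod γ ew)

  ∣-cong-mod : ∀ {d x y} → d ∣ n → x ≡ y [mod n ] → d ∣ x → d ∣ y
  ∣-cong-mod d∣n e d∣x = ∣n∣m%n⇒∣m d∣n (subst (_ ∣_) e (%-presˡ-∣ d∣x d∣n))

  HasVal3-cong-mod : ∀ {v x y} → 3 ^ suc v ∣ n → x ≡ y [mod n ] → HasVal3 x v → HasVal3 y v
  HasVal3-cong-mod 3^v+1∣n e (3^v∣x , 3^v+1∤x) =
    ∣-cong-mod (∣-trans (n∣m*n 3) 3^v+1∣n) e 3^v∣x ,
    λ 3^v+1∣y → 3^v+1∤x (∣-cong-mod 3^v+1∣n (sym e) 3^v+1∣y)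

HasVal3-3^* : ∀ k {n v} → HasVal3 n v → HasVal3 (3 ^ k * n) (k + v)
HasVal3-3^* k {n} {v} (3^v∣n , 3^v+1∤n) =
  subst (_∣ 3 ^ k * n) (sym (^-distribˡ-+-* 3 k v)) (*-monoʳ-∣ (3 ^ k) 3^v∣n) ,
  λ d → 3^v+1∤n (*-cancelˡ-∣ (3 ^ k) {{m^n≢0 3 k}} (subst (_∣ 3 ^ k * n) 3^[1+k+v]≡ d))
  where
  3^[1+k+v]≡ : 3 ^ suc (k + v) ≡ 3 ^ k * 3 ^ suc v
  3^[1+k+v]≡ = trans (cong (3 ^_) (sym (+-suc k v))) (^-distribˡ-+-* 3 k (suc v))

HasVal3? : ∀ n v → Dec (HasVal3 n v)
HasVal3? n v = 3 ^ v ∣? n ×-dec ¬? (3 ^ suc v ∣? n)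

3^[1+v]∣9 : ∀ {v} → v ≤ 1 → 3 ^ suc v ∣ 9
3^[1+v]∣9 z≤n       = divides 3 refl
3^[1+v]∣9 (s≤s z≤n) = ∣-refl

periodic-% : ∀ {A : Set} (f : ℕ → A) p .{{_ : NonZero p}} →
             (∀ i → f (i + p) ≡ f i) → ∀ i → f (i % p) ≡ f i
periodic-% f p f-per i = trans (sym (f-per-* (i / p))) (cong f (sym (m≡m%n+[m/n]*n i p)))
  where
  f-per-* : ∀ m → f (i % p + m * p) ≡ f (i % p)
  f-per-* zero    = cong f (+-identityʳ (i % p))
  f-per-* (suc m) = begin
    f (i % p + (p + m * p))  ≡⟨ cong f (trans (cong (i % p +_) (+-comm p (m * p)))
                                              (sym (+-assoc (i % p) (m * p) p))) ⟩
    f (i % p + m * p + p)    ≡⟨ f-per (i % p + m * p) ⟩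
    f (i % p + m * p)        ≡⟨ f-per-* m ⟩
    f (i % p)                ∎
    where open ≡-Reasoning

record Triple : Set where
  constructor ⟨_,_,_⟩
  field
    fst snd thd : ℕ
open Triple

entry : ℕ → Triple → ℕ
entry 0 = fst
entry 1 = snd
entry _ = thd

infixr 7 _·_

_·_ : ℕ → Triple → Triple
p · ⟨ a , b , c ⟩ = ⟨ p * a , p * b , p * c ⟩

entry-· : ∀ r p t → entry r (p · t) ≡ p * entry r t
entry-· 0 p t = refl
entry-· 1 p t = refl
entry-· (suc (suc r)) p t = refl

shift : Triple → Triple
shift ⟨ x , y , z ⟩ = ⟨ y , z , 12 * z + 6 * y + 12 * x ⟩

window : ℕ → Triple
window i = ⟨ U i , U (1 + i) , U (2 + i) ⟩

window-+3 : ∀ i → window (3 + i) ≡ shift (shift (shift (window i)))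
window-+3 i = refl

U≡entry-window : ∀ r k → r < 3 → U (r + k) ≡ entry r (window k)
U≡entry-window 0 k _ = refl
U≡entry-window 1 k _ = refl
U≡entry-window 2 k _ = refl
U≡entry-window (suc (suc (suc _))) _ (s≤s (s≤s (s≤s ())))

step : Triple → Triple
step ⟨ a , b , c ⟩ = ⟨ x , y , 12 * y + 6 * x + 4 * c ⟩
  where
  x y : ℕ
  x = 4 * c + 2 * b + 4 * a
  y = 12 * x + 2 * c + 4 * b

shift³-· : ∀ p t → shift (shift (shift (p · t))) ≡ (3 * p) · step t
shift³-· p ⟨ a , b , c ⟩ = begin
  shift (shift ⟨ p * b , p * c , 12 * (p * c) + 6 * (p * b) + 12 * (p * a) ⟩)
    ≡⟨ cong (λ u → shift (shift ⟨ p * b , p * c , u ⟩)) (lin₁ p a b c) ⟩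
  shift ⟨ p * c , 3 * p * x , 12 * (3 * p * x) + 6 * (p * c) + 12 * (p * b) ⟩
    ≡⟨ cong (λ u → shift ⟨ p * c , 3 * p * x , u ⟩) (lin₂ p x b c) ⟩
  ⟨ 3 * p * x , 3 * p * y , 12 * (3 * p * y) + 6 * (3 * p * x) + 12 * (p * c) ⟩
    ≡⟨ cong (λ u → ⟨ 3 * p * x , 3 * p * y , u ⟩) (lin₃ p x y c) ⟩
  (3 * p) · step ⟨ a , b , c ⟩
    ∎
  where
  open ≡-Reasoning
  x y : ℕ
  x = 4 * c + 2 * b + 4 * a
  y = 12 * x + 2 * c + 4 * b
  lin₁ : ∀ p a b c → 12 * (p * c) + 6 * (p * b) + 12 * (p * a) ≡ 3 * p * (4 * c + 2 * b + 4 * a)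
  lin₁ = solve-∀
  lin₂ : ∀ p x b c → 12 * (3 * p * x) + 6 * (p * c) + 12 * (p * b) ≡ 3 * p * (12 * x + 2 * c + 4 * b)
  lin₂ = solve-∀
  lin₃ : ∀ p x y c → 12 * (3 * p * y) + 6 * (3 * p * x) + 12 * (p * c) ≡ 3 * p * (12 * y + 6 * x + 4 * c)
  lin₃ = solve-∀

block : ℕ → Triple
block zero    = ⟨ 1 , 13 , 163 ⟩
block (suc k) = step (block k)

window≡3^k·block : ∀ k → window (k * 3) ≡ 3 ^ k · block k
window≡3^k·block zero    = refl
window≡3^k·block (suc k) = begin
  window (3 + k * 3)                       ≡⟨ window-+3 (k * 3) ⟩
  shift (shift (shift (window (k * 3))))   ≡⟨ cong (λ t → shift (shift (shift t))) (window≡3^k·block k) ⟩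
  shift (shift (shift (3 ^ k · block k)))  ≡⟨ shift³-· (3 ^ k) (block k) ⟩
  3 ^ suc k · block (suc k)                ∎
  where open ≡-Reasoning

V : ℕ → ℕ
V i = entry (i % 3) (block (i / 3))

U≡3^[i/3]*V : ∀ i → U i ≡ 3 ^ (i / 3) * V i
U≡3^[i/3]*V i = begin
  U i                                         ≡⟨ cong U (m≡m%n+[m/n]*n i 3) ⟩
  U (i % 3 + i / 3 * 3)                       ≡⟨ U≡entry-window (i % 3) (i / 3 * 3) (m%n<n i 3) ⟩
  entry (i % 3) (window (i / 3 * 3))          ≡⟨ cong (entry (i % 3)) (window≡3^k·block (i / 3)) ⟩
  entry (i % 3) (3 ^ (i / 3) · block (i / 3)) ≡⟨ entry-· (i % 3) (3 ^ (i / 3)) (block (i / 3)) ⟩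
  3 ^ (i / 3) * V i                           ∎
  where open ≡-Reasoning

infix 4 _≈_[mod_]

record _≈_[mod_] (s t : Triple) (n : ℕ) .{{_ : NonZero n}} : Set where
  constructor ≈-mod
  field
    fst-≡ : fst s ≡ fst t [mod n ]
    snd-≡ : snd s ≡ snd t [mod n ]
    thd-≡ : thd s ≡ thd t [mod n ]

_≈?_[mod_] : ∀ s t n .{{_ : NonZero n}} → Dec (s ≈ t [mod n ])
s ≈? t [mod n ] = map′ (λ (e₁ , e₂ , e₃) → ≈-mod e₁ e₂ e₃) (λ (≈-mod e₁ e₂ e₃) → e₁ , e₂ , e₃)
  (fst s % n ≟ fst t % n ×-dec snd s % n ≟ snd t % n ×-dec thd s % n ≟ thd t % n)

module _ {n : ℕ} .{{_ : NonZero n}} where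

  ≈-trans : ∀ {s t u} → s ≈ t [mod n ] → t ≈ u [mod n ] → s ≈ u [mod n ]
  ≈-trans (≈-mod e₁ e₂ e₃) (≈-mod f₁ f₂ f₃) = ≈-mod (trans e₁ f₁) (trans e₂ f₂) (trans e₃ f₃)

  entry-cong-mod : ∀ r {s t} → s ≈ t [mod n ] → entry r s ≡ entry r t [mod n ]
  entry-cong-mod 0             = _≈_[mod_].fst-≡
  entry-cong-mod 1             = _≈_[mod_].snd-≡
  entry-cong-mod (suc (suc _)) = _≈_[mod_].thd-≡

  step-cong-mod : ∀ {s t} → s ≈ t [mod n ] → step s ≈ step t [mod n ]
  step-cong-mod {s} {t} (≈-mod ea eb ec) = ≈-mod ex ey (lincomb-cong-mod 12 6 4 ey ex ec)
    where
    ex : fst (step s) ≡ fst (step t) [mod n ]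
    ex = lincomb-cong-mod 4 2 4 ec eb ea
    ey : snd (step s) ≡ snd (step t) [mod n ]
    ey = lincomb-cong-mod 12 2 4 ex ec eb

-- the residues of block 0, …, block 8 modulo 9
period : ℕ → Triple
period 0 = ⟨ 1 , 4 , 1 ⟩
period 1 = ⟨ 7 , 3 , 1 ⟩
period 2 = ⟨ 2 , 2 , 4 ⟩
period 3 = ⟨ 1 , 1 , 7 ⟩
period 4 = ⟨ 7 , 3 , 7 ⟩
period 5 = ⟨ 8 , 5 , 1 ⟩
period 6 = ⟨ 1 , 7 , 4 ⟩
period 7 = ⟨ 7 , 3 , 4 ⟩
period _ = ⟨ 5 , 8 , 7 ⟩

step-period : ∀ {j} → j < 9 → step (period j) ≈ period (suc j % 9) [mod 9 ]
step-period = from-yes (allUpTo? (λ j → step (period j) ≈? period (suc j % 9) [mod 9 ]) 9)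

block≈period : ∀ k → block k ≈ period (k % 9) [mod 9 ]
block≈period zero    = ≈-mod refl refl refl
block≈period (suc k) = subst (λ j → block (suc k) ≈ period j [mod 9 ]) (sym (%-distribˡ-+ 1 k 9))
  (≈-trans (step-cong-mod (block≈period k)) (step-period (m%n<n k 9)))

V₉ : ℕ → ℕ
V₉ i = entry (i % 3) (period (i / 3 % 9))

V≡V₉ : ∀ i → V i ≡ V₉ i [mod 9 ]
V≡V₉ i = entry-cong-mod (i % 3) (block≈period (i / 3))

V₉-+27 : ∀ i → V₉ (i + 27) ≡ V₉ i
V₉-+27 i = begin
  entry ((i + 27) % 3) (period ((i + 27) / 3 % 9))
    ≡⟨ cong₂ (λ r k → entry r (period (k % 9))) ([m+kn]%n≡m%n i 9 3) (+-distrib-/-∣ʳ i (divides 9 refl)) ⟩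
  entry (i % 3) (period ((i / 3 + 9) % 9))
    ≡⟨ cong (λ q → entry (i % 3) (period q)) ([m+kn]%n≡m%n (i / 3) 1 9) ⟩
  V₉ i
    ∎
  where open ≡-Reasoning

corr-+27 : ∀ i → corr (i + 27) ≡ corr i
corr-+27 i rewrite [m+kn]%n≡m%n i 3 9 {{_}} = refl

V₉-table : ∀ {j} → j < 27 → corr j ≤ 1 × HasVal3 (V₉ j) (corr j)
V₉-table = from-yes (allUpTo? (λ j → corr j ≤? 1 ×-dec HasVal3? (V₉ j) (corr j)) 27)

HasVal3-V : ∀ i → HasVal3 (V i) (corr i)
HasVal3-V i = HasVal3-cong-mod {v = corr i} (3^[1+v]∣9 corr≤1) (sym (V≡V₉ i)) HasVal3-V₉
  where
  corr-%27 : corr (i % 27) ≡ corr i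
  corr-%27 = periodic-% corr 27 corr-+27 i
  corr≤1 : corr i ≤ 1
  corr≤1 = subst (_≤ 1) corr-%27 (proj₁ (V₉-table (m%n<n i 27)))
  HasVal3-V₉ : HasVal3 (V₉ i) (corr i)
  HasVal3-V₉ = subst₂ HasVal3 (periodic-% V₉ 27 V₉-+27 i) corr-%27 (proj₂ (V₉-table (m%n<n i 27)))

theorem6p1 : ∀ (i : ℕ) → HasVal3 (U i) (i / 3 + corr i)
theorem6p1 i = subst (λ n → HasVal3 n (i / 3 + corr i)) (sym (U≡3^[i/3]*V i))
  (HasVal3-3^* (i / 3) (HasVal3-V i))
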